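{- Let $a,n$ be integers with $n>1$, $1\le a<n$ and $\gcd(a,n)=1$, and let $a^{ -1}$ be the integer with $1\le a^{ -1}<n$ and $a\,a^{ -1}\equiv 1 \pmod n$. Then the four parallelograms $P_{a,n}$, $P_{n-a,n}$, $P_{a^{ -1},n}$, $P_{n-a^{ -1},n}$ are pairwise unimodularly equivalent.
   Context: For integers $1\le b<n$ with $\gcd(b,n)=1$, $P_{b,n}$ denotes the lattice parallelogram with vertices $(0,0),(1,0),(b,n),(b+1,n)$. An affine unimodular map is a map $T(\mathbf{x})=M\mathbf{x}+\mathbf{w}$ with $M$ a $2\times2$ integer matrix of determinant $\pm1$ and $\mathbf{w}\in\mathbb{Z}^2$. Two lattice polygons $Q_1,Q_2$ are unimodularly equivalent if there is an affine unimodular map $T$ with $T(Q_1)=Q_2$.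
   Formalization: The parallelograms $P_{b,n}$ are taken as their sets of points with rational coordinates, and the affine unimodular maps act on ℚ². -}

module Defs where

open import Data.Nat as ℕ using (ℕ)
open import Data.Integer as ℤ using (ℤ; +_)
open import Data.Rational using (ℚ; _/_; 0ℚ; 1ℚ; _+_; _*_; _≤_)
open import Data.Sum using (_⊎_)
open import Data.Product using (_×_; _,_; ∃; Σ)
open import Relation.Binary.PropositionalEquality using (_≡_)

ι : ℤ → ℚ
ι z = z / 1

Point : Set
Point = ℚ × ℚ

ConvHull4 : (ℤ × ℤ) → (ℤ × ℤ) → (ℤ × ℤ) → (ℤ × ℤ) → Point → Set
ConvHull4 (x₁ , y₁) (x₂ , y₂) (x₃ , y₃) (x₄ , y₄) (x , y) =
  ∃ λ (l₁ : ℚ) → ∃ λ (l₂ : ℚ) → ∃ λ (l₃ : ℚ) → ∃ λ (l₄ : ℚ) →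
    (0ℚ ≤ l₁) × (0ℚ ≤ l₂) × (0ℚ ≤ l₃) × (0ℚ ≤ l₄) ×
    (l₁ + l₂ + l₃ + l₄ ≡ 1ℚ) ×
    (x ≡ l₁ * ι x₁ + l₂ * ι x₂ + l₃ * ι x₃ + l₄ * ι x₄) ×
    (y ≡ l₁ * ι y₁ + l₂ * ι y₂ + l₃ * ι y₃ + l₄ * ι y₄)

P : ℕ → ℕ → Point → Set
P b n = ConvHull4 (+ 0 , + 0) (+ 1 , + 0) (+ b , + n) (+ (ℕ.suc b) , + n)

record AffUnimod : Set where
  field
    m₁₁ m₁₂ m₂₁ m₂₂ w₁ w₂ : ℤ
    det±1 : (m₁₁ ℤ.* m₂₂ ℤ.- m₁₂ ℤ.* m₂₁ ≡ ℤ.+ 1) ⊎ (m₁₁ ℤ.* m₂₂ ℤ.- m₁₂ ℤ.* m₂₁ ≡ ℤ.- (+ 1))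
  apply : Point → Point
  apply (x , y) = (ι m₁₁ * x + ι m₁₂ * y + ι w₁ , ι m₂₁ * x + ι m₂₂ * y + ι w₂)

Maps : AffUnimod → (Point → Set) → (Point → Set) → Set
Maps T Q₁ Q₂ =
  ((p : Point) → Q₁ p → Q₂ (AffUnimod.apply T p)) ×
  ((q : Point) → Q₂ q → ∃ λ p → Q₁ p × (AffUnimod.apply T p ≡ q))

UnimodEquiv : (Point → Set) → (Point → Set) → Set
UnimodEquiv Q₁ Q₂ = ∃ λ T → Maps T Q₁ Q₂

open import Data.Fin using (Fin; zero; suc)

lookup4 : ℕ → ℕ → ℕ → ℕ → Fin 4 → ℕ
lookup4 x₀ x₁ x₂ x₃ zero = x₀
lookup4 x₀ x₁ x₂ x₃ (suc zero) = x₁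
lookup4 x₀ x₁ x₂ x₃ (suc (suc zero)) = x₂
lookup4 x₀ x₁ x₂ x₃ (suc (suc (suc zero))) = x₃

{-# OPTIONS --safe #-}

-- The reflection (x, y) ↦ (1 − x + y, y) maps P_{b,n} onto P_{n−b,n}, and when bc = 1 + kn the
-- linear map with matrix [[c, −k], [n, −b]] (determinant −1) maps P_{b,n} onto P_{c,n}, sending the
-- edge vectors (1, 0) and (b, n) to (c, n) and (1, 0). Affine maps preserve convex combinations, so
-- it suffices to follow the four vertices. Since a · a⁻¹ = 1 + qn, composing these maps links each
-- of the four parallelograms to P_{a,n}.
module Submission where

open import Defs

-- A separate module, so that the rational operators opened here do not clash with ℕ's in lemma9.
module UnimodularEquivalence where

  open import Algebra.Bundles using (CommutativeMonoid)
  import Algebra.Properties.CommutativeSemigroup as CommutativeSemigroupProperties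
  import Data.Nat as ℕ
  open import Data.Integer as ℤ using (ℤ; +_)
  open import Data.Integer.Properties using (pos-*)
  open import Data.Integer.Tactic.RingSolver using (solve-∀)
  open import Data.Product using (Σ; _×_; _,_; proj₁; proj₂)
  open import Data.Rational using (ℚ; 0ℚ; 1ℚ; toℚᵘ; _+_; _*_)
  open import Data.Rational.Properties
    using (toℚᵘ-injective; toℚᵘ-fromℚᵘ; toℚᵘ-homo-+; toℚᵘ-homo-*; +-comm; *-identityˡ; +-0-commutativeMonoid)
  open import Data.Rational.Solver using (module +-*-Solver)
  open import Data.Rational.Unnormalised as ℚᵘ using (mkℚᵘ; *≡*)
  import Data.Rational.Unnormalised.Properties as ℚᵘ
  open import Data.Sum using (_⊎_; inj₁; inj₂)
  open import Relation.Binary.PropositionalEquality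
    using (_≡_; refl; sym; trans; cong; cong₂; subst; module ≡-Reasoning)
  open import Relation.Unary using (_⊆_; _≐_)

  open AffUnimod using (apply)

  ι-+ : ∀ x y → ι (x ℤ.+ y) ≡ ι x + ι y
  ι-+ x y = toℚᵘ-injective (begin
    toℚᵘ (ι (x ℤ.+ y))          ≈⟨ toℚᵘ-fromℚᵘ (mkℚᵘ (x ℤ.+ y) 0) ⟩
    mkℚᵘ (x ℤ.+ y) 0            ≈⟨ *≡* (denominators x y) ⟩
    mkℚᵘ x 0 ℚᵘ.+ mkℚᵘ y 0      ≈⟨ ℚᵘ.+-cong (toℚᵘ-fromℚᵘ (mkℚᵘ x 0)) (toℚᵘ-fromℚᵘ (mkℚᵘ y 0)) ⟨
    toℚᵘ (ι x) ℚᵘ.+ toℚᵘ (ι y)  ≈⟨ toℚᵘ-homo-+ (ι x) (ι y) ⟨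
    toℚᵘ (ι x + ι y)            ∎)
    where
    open ℚᵘ.≃-Reasoning
    denominators : ∀ x y → (x ℤ.+ y) ℤ.* + 1 ≡ (x ℤ.* + 1 ℤ.+ y ℤ.* + 1) ℤ.* + 1
    denominators = solve-∀

  ι-* : ∀ x y → ι (x ℤ.* y) ≡ ι x * ι y
  ι-* x y = toℚᵘ-injective (begin
    toℚᵘ (ι (x ℤ.* y))          ≈⟨ toℚᵘ-fromℚᵘ (mkℚᵘ (x ℤ.* y) 0) ⟩
    mkℚᵘ (x ℤ.* y) 0            ≈⟨ *≡* refl ⟩
    mkℚᵘ x 0 ℚᵘ.* mkℚᵘ y 0      ≈⟨ ℚᵘ.*-cong (toℚᵘ-fromℚᵘ (mkℚᵘ x 0)) (toℚᵘ-fromℚᵘ (mkℚᵘ y 0)) ⟨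
    toℚᵘ (ι x) ℚᵘ.* toℚᵘ (ι y)  ≈⟨ toℚᵘ-homo-* (ι x) (ι y) ⟨
    toℚᵘ (ι x * ι y)            ∎)
    where open ℚᵘ.≃-Reasoning

  ι-linear : ∀ a x b y → ι (a ℤ.* x ℤ.+ b ℤ.* y) ≡ ι a * ι x + ι b * ι y
  ι-linear a x b y = trans (ι-+ (a ℤ.* x) (b ℤ.* y)) (cong₂ _+_ (ι-* a x) (ι-* b y))

  ι-affine : ∀ a x b y w → ι (a ℤ.* x ℤ.+ b ℤ.* y ℤ.+ w) ≡ ι a * ι x + ι b * ι y + ι w
  ι-affine a x b y w = trans (ι-+ (a ℤ.* x ℤ.+ b ℤ.* y) w) (cong (_+ ι w) (ι-linear a x b y))

  ι² : ℤ × ℤ → Point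
  ι² (x , y) = ι x , ι y

  applyℤ : AffUnimod → ℤ × ℤ → ℤ × ℤ
  applyℤ T (x , y) = m₁₁ ℤ.* x ℤ.+ m₁₂ ℤ.* y ℤ.+ w₁ , m₂₁ ℤ.* x ℤ.+ m₂₂ ℤ.* y ℤ.+ w₂
    where open AffUnimod T

  apply-ι² : ∀ T v → apply T (ι² v) ≡ ι² (applyℤ T v)
  apply-ι² T (x , y) = sym (cong₂ _,_ (ι-affine m₁₁ x m₁₂ y w₁) (ι-affine m₂₁ x m₂₂ y w₂))
    where open AffUnimod T

  infixl 6 _⊕_
  infixl 7 _·_

  _⊕_ : Point → Point → Point
  (x , y) ⊕ (x′ , y′) = x + x′ , y + y′

  _·_ : ℚ → Point → Point
  l · (x , y) = l * x , l * y

  affine-combination : ∀ a b w l₁ l₂ l₃ l₄ x₁ x₂ x₃ x₄ y₁ y₂ y₃ y₄ → l₁ + l₂ + l₃ + l₄ ≡ 1ℚ →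
    a * (l₁ * x₁ + l₂ * x₂ + l₃ * x₃ + l₄ * x₄) + b * (l₁ * y₁ + l₂ * y₂ + l₃ * y₃ + l₄ * y₄) + w
    ≡ l₁ * (a * x₁ + b * y₁ + w) + l₂ * (a * x₂ + b * y₂ + w)
      + l₃ * (a * x₃ + b * y₃ + w) + l₄ * (a * x₄ + b * y₄ + w)
  affine-combination a b w l₁ l₂ l₃ l₄ x₁ x₂ x₃ x₄ y₁ y₂ y₃ y₄ Σl≡1 = begin
    linear + w                        ≡⟨ cong (λ s → linear + s) (sym (*-identityˡ w)) ⟩
    linear + 1ℚ * w                   ≡⟨ cong (λ s → linear + s * w) (sym Σl≡1) ⟩
    linear + (l₁ + l₂ + l₃ + l₄) * w  ≡⟨ distribute a b w l₁ l₂ l₃ l₄ x₁ x₂ x₃ x₄ y₁ y₂ y₃ y₄ ⟩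
    _                                 ∎
    where
    open ≡-Reasoning
    open +-*-Solver
    linear : ℚ
    linear = a * (l₁ * x₁ + l₂ * x₂ + l₃ * x₃ + l₄ * x₄) + b * (l₁ * y₁ + l₂ * y₂ + l₃ * y₃ + l₄ * y₄)
    distribute : ∀ a b w l₁ l₂ l₃ l₄ x₁ x₂ x₃ x₄ y₁ y₂ y₃ y₄ →
      a * (l₁ * x₁ + l₂ * x₂ + l₃ * x₃ + l₄ * x₄) + b * (l₁ * y₁ + l₂ * y₂ + l₃ * y₃ + l₄ * y₄)
        + (l₁ + l₂ + l₃ + l₄) * w
      ≡ l₁ * (a * x₁ + b * y₁ + w) + l₂ * (a * x₂ + b * y₂ + w)
        + l₃ * (a * x₃ + b * y₃ + w) + l₄ * (a * x₄ + b * y₄ + w)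
    distribute = solve 15 (λ a b w l₁ l₂ l₃ l₄ x₁ x₂ x₃ x₄ y₁ y₂ y₃ y₄ →
        a :* (l₁ :* x₁ :+ l₂ :* x₂ :+ l₃ :* x₃ :+ l₄ :* x₄) :+ b :* (l₁ :* y₁ :+ l₂ :* y₂ :+ l₃ :* y₃ :+ l₄ :* y₄)
          :+ (l₁ :+ l₂ :+ l₃ :+ l₄) :* w
        := l₁ :* (a :* x₁ :+ b :* y₁ :+ w) :+ l₂ :* (a :* x₂ :+ b :* y₂ :+ w)
          :+ l₃ :* (a :* x₃ :+ b :* y₃ :+ w) :+ l₄ :* (a :* x₄ :+ b :* y₄ :+ w)) refl

  apply-combination : ∀ T l₁ l₂ l₃ l₄ p₁ p₂ p₃ p₄ → l₁ + l₂ + l₃ + l₄ ≡ 1ℚ →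
    apply T (l₁ · p₁ ⊕ l₂ · p₂ ⊕ l₃ · p₃ ⊕ l₄ · p₄)
    ≡ l₁ · apply T p₁ ⊕ l₂ · apply T p₂ ⊕ l₃ · apply T p₃ ⊕ l₄ · apply T p₄
  apply-combination T l₁ l₂ l₃ l₄ (x₁ , y₁) (x₂ , y₂) (x₃ , y₃) (x₄ , y₄) Σl≡1 = cong₂ _,_
    (affine-combination (ι m₁₁) (ι m₁₂) (ι w₁) l₁ l₂ l₃ l₄ x₁ x₂ x₃ x₄ y₁ y₂ y₃ y₄ Σl≡1)
    (affine-combination (ι m₂₁) (ι m₂₂) (ι w₂) l₁ l₂ l₃ l₄ x₁ x₂ x₃ x₄ y₁ y₂ y₃ y₄ Σl≡1)
    where open AffUnimod T

  ConvHull4-image : ∀ T A B C D {A′ B′ C′ D′} →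
    applyℤ T A ≡ A′ → applyℤ T B ≡ B′ → applyℤ T C ≡ C′ → applyℤ T D ≡ D′ →
    Maps T (ConvHull4 A B C D) (ConvHull4 A′ B′ C′ D′)
  ConvHull4-image T A@(_ , _) B@(_ , _) C@(_ , _) D@(_ , _) refl refl refl refl = image , preimage
    where
    image-of-combination : ∀ l₁ l₂ l₃ l₄ → l₁ + l₂ + l₃ + l₄ ≡ 1ℚ →
      apply T (l₁ · ι² A ⊕ l₂ · ι² B ⊕ l₃ · ι² C ⊕ l₄ · ι² D)
      ≡ l₁ · ι² (applyℤ T A) ⊕ l₂ · ι² (applyℤ T B) ⊕ l₃ · ι² (applyℤ T C) ⊕ l₄ · ι² (applyℤ T D)
    image-of-combination l₁ l₂ l₃ l₄ Σl≡1 = trans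
      (apply-combination T l₁ l₂ l₃ l₄ (ι² A) (ι² B) (ι² C) (ι² D) Σl≡1)
      (cong₂ _⊕_ (cong₂ _⊕_ (cong₂ _⊕_ (cong (l₁ ·_) (apply-ι² T A)) (cong (l₂ ·_) (apply-ι² T B)))
                            (cong (l₃ ·_) (apply-ι² T C)))
                 (cong (l₄ ·_) (apply-ι² T D)))
    image : ∀ p → ConvHull4 A B C D p →
      ConvHull4 (applyℤ T A) (applyℤ T B) (applyℤ T C) (applyℤ T D) (apply T p)
    image _ (l₁ , l₂ , l₃ , l₄ , l₁≥0 , l₂≥0 , l₃≥0 , l₄≥0 , Σl≡1 , refl , refl) =
      l₁ , l₂ , l₃ , l₄ , l₁≥0 , l₂≥0 , l₃≥0 , l₄≥0 , Σl≡1 ,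
      cong proj₁ (image-of-combination l₁ l₂ l₃ l₄ Σl≡1) ,
      cong proj₂ (image-of-combination l₁ l₂ l₃ l₄ Σl≡1)
    preimage : ∀ q → ConvHull4 (applyℤ T A) (applyℤ T B) (applyℤ T C) (applyℤ T D) q →
      Σ Point λ p → ConvHull4 A B C D p × apply T p ≡ q
    preimage _ (l₁ , l₂ , l₃ , l₄ , l₁≥0 , l₂≥0 , l₃≥0 , l₄≥0 , Σl≡1 , refl , refl) =
      l₁ · ι² A ⊕ l₂ · ι² B ⊕ l₃ · ι² C ⊕ l₄ · ι² D ,
      (l₁ , l₂ , l₃ , l₄ , l₁≥0 , l₂≥0 , l₃≥0 , l₄≥0 , Σl≡1 , refl , refl) ,
      image-of-combination l₁ l₂ l₃ l₄ Σl≡1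

  open CommutativeSemigroupProperties (CommutativeMonoid.commutativeSemigroup +-0-commutativeMonoid)
    using (xy∙z≈xz∙y)

  +-swap-pairs : ∀ a b c d → a + b + c + d ≡ b + a + d + c
  +-swap-pairs a b c d = trans (cong (λ s → s + c + d) (+-comm a b)) (xy∙z≈xz∙y (b + a) c d)

  +-swap-middle : ∀ a b c d → a + b + c + d ≡ a + c + b + d
  +-swap-middle a b c d = cong (_+ d) (xy∙z≈xz∙y a b c)

  ConvHull4-swap-pairs : ∀ A B C D → ConvHull4 A B C D ⊆ ConvHull4 B A D C
  ConvHull4-swap-pairs (x₁ , y₁) (x₂ , y₂) (x₃ , y₃) (x₄ , y₄)
    (l₁ , l₂ , l₃ , l₄ , l₁≥0 , l₂≥0 , l₃≥0 , l₄≥0 , Σl≡1 , x≡ , y≡) =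
    l₂ , l₁ , l₄ , l₃ , l₂≥0 , l₁≥0 , l₄≥0 , l₃≥0 , trans (sym (+-swap-pairs l₁ l₂ l₃ l₄)) Σl≡1 ,
    trans x≡ (+-swap-pairs (l₁ * ι x₁) (l₂ * ι x₂) (l₃ * ι x₃) (l₄ * ι x₄)) ,
    trans y≡ (+-swap-pairs (l₁ * ι y₁) (l₂ * ι y₂) (l₃ * ι y₃) (l₄ * ι y₄))

  ConvHull4-swap-middle : ∀ A B C D → ConvHull4 A B C D ⊆ ConvHull4 A C B D
  ConvHull4-swap-middle (x₁ , y₁) (x₂ , y₂) (x₃ , y₃) (x₄ , y₄)
    (l₁ , l₂ , l₃ , l₄ , l₁≥0 , l₂≥0 , l₃≥0 , l₄≥0 , Σl≡1 , x≡ , y≡) =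
    l₁ , l₃ , l₂ , l₄ , l₁≥0 , l₃≥0 , l₂≥0 , l₄≥0 , trans (sym (+-swap-middle l₁ l₂ l₃ l₄)) Σl≡1 ,
    trans x≡ (+-swap-middle (l₁ * ι x₁) (l₂ * ι x₂) (l₃ * ι x₃) (l₄ * ι x₄)) ,
    trans y≡ (+-swap-middle (l₁ * ι y₁) (l₂ * ι y₂) (l₃ * ι y₃) (l₄ * ι y₄))

  ConvHull4-≐-swap-pairs : ∀ A B C D → ConvHull4 A B C D ≐ ConvHull4 B A D C
  ConvHull4-≐-swap-pairs A B C D = ConvHull4-swap-pairs A B C D , ConvHull4-swap-pairs B A D C

  ConvHull4-≐-swap-middle : ∀ A B C D → ConvHull4 A B C D ≐ ConvHull4 A C B D
  ConvHull4-≐-swap-middle A B C D = ConvHull4-swap-middle A B C D , ConvHull4-swap-middle A C B D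

  Maps-respʳ-≐ : ∀ T {Q₁ Q₂ Q₃} → Q₂ ≐ Q₃ → Maps T Q₁ Q₂ → Maps T Q₁ Q₃
  Maps-respʳ-≐ _ (Q₂⊆Q₃ , Q₃⊆Q₂) (image , preimage) =
    (λ p p∈Q₁ → Q₂⊆Q₃ (image p p∈Q₁)) , (λ q q∈Q₃ → preimage q (Q₃⊆Q₂ q∈Q₃))

  infix 4 _≅_

  _≅_ : (Point → Set) → (Point → Set) → Set
  _≅_ = UnimodEquiv

  identity : AffUnimod
  identity = record
    { m₁₁ = + 1 ; m₁₂ = + 0 ; m₂₁ = + 0 ; m₂₂ = + 1 ; w₁ = + 0 ; w₂ = + 0 ; det±1 = inj₁ refl }

  apply-identity : ∀ p → apply identity p ≡ p
  apply-identity (x , y) = cong₂ _,_ (first x y) (second x y)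
    where
    open +-*-Solver
    first : ∀ x y → 1ℚ * x + 0ℚ * y + 0ℚ ≡ x
    first = solve 2 (λ x y → con 1ℚ :* x :+ con 0ℚ :* y :+ con 0ℚ := x) refl
    second : ∀ x y → 0ℚ * x + 1ℚ * y + 0ℚ ≡ y
    second = solve 2 (λ x y → con 0ℚ :* x :+ con 1ℚ :* y :+ con 0ℚ := y) refl

  ≅-refl : ∀ {Q} → Q ≅ Q
  ≅-refl {Q} = identity ,
    (λ p p∈Q → subst Q (sym (apply-identity p)) p∈Q) , (λ q q∈Q → q , q∈Q , apply-identity q)

  ±1-* : ∀ {x y} → x ≡ + 1 ⊎ x ≡ ℤ.- (+ 1) → y ≡ + 1 ⊎ y ≡ ℤ.- (+ 1) →
    x ℤ.* y ≡ + 1 ⊎ x ℤ.* y ≡ ℤ.- (+ 1)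
  ±1-* (inj₁ refl) (inj₁ refl) = inj₁ refl
  ±1-* (inj₁ refl) (inj₂ refl) = inj₂ refl
  ±1-* (inj₂ refl) (inj₁ refl) = inj₂ refl
  ±1-* (inj₂ refl) (inj₂ refl) = inj₁ refl

  det-* : ∀ a b c d e f g h →
    (a ℤ.* e ℤ.+ b ℤ.* g) ℤ.* (c ℤ.* f ℤ.+ d ℤ.* h) ℤ.- (a ℤ.* f ℤ.+ b ℤ.* h) ℤ.* (c ℤ.* e ℤ.+ d ℤ.* g)
    ≡ (a ℤ.* d ℤ.- b ℤ.* c) ℤ.* (e ℤ.* h ℤ.- f ℤ.* g)
  det-* = solve-∀

  infixr 9 _∘_

  _∘_ : AffUnimod → AffUnimod → AffUnimod
  S ∘ T = record
    { m₁₁ = S.m₁₁ ℤ.* T.m₁₁ ℤ.+ S.m₁₂ ℤ.* T.m₂₁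
    ; m₁₂ = S.m₁₁ ℤ.* T.m₁₂ ℤ.+ S.m₁₂ ℤ.* T.m₂₂
    ; m₂₁ = S.m₂₁ ℤ.* T.m₁₁ ℤ.+ S.m₂₂ ℤ.* T.m₂₁
    ; m₂₂ = S.m₂₁ ℤ.* T.m₁₂ ℤ.+ S.m₂₂ ℤ.* T.m₂₂
    ; w₁ = S.m₁₁ ℤ.* T.w₁ ℤ.+ S.m₁₂ ℤ.* T.w₂ ℤ.+ S.w₁
    ; w₂ = S.m₂₁ ℤ.* T.w₁ ℤ.+ S.m₂₂ ℤ.* T.w₂ ℤ.+ S.w₂
    ; det±1 = subst (λ δ → δ ≡ + 1 ⊎ δ ≡ ℤ.- (+ 1))
        (sym (det-* S.m₁₁ S.m₁₂ S.m₂₁ S.m₂₂ T.m₁₁ T.m₁₂ T.m₂₁ T.m₂₂))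
        (±1-* S.det±1 T.det±1)
    }
    where
    module S = AffUnimod S
    module T = AffUnimod T

  apply-∘ : ∀ S T p → apply (S ∘ T) p ≡ apply S (apply T p)
  apply-∘ S T (x , y) = cong₂ _,_ (row S.m₁₁ S.m₁₂ S.w₁) (row S.m₂₁ S.m₂₂ S.w₂)
    where
    module S = AffUnimod S
    module T = AffUnimod T
    compose : ∀ p q r a b c d e f x y →
      (p * a + q * c) * x + (p * b + q * d) * y + (p * e + q * f + r)
      ≡ p * (a * x + b * y + e) + q * (c * x + d * y + f) + r
    compose = solve 11 (λ p q r a b c d e f x y →
        (p :* a :+ q :* c) :* x :+ (p :* b :+ q :* d) :* y :+ (p :* e :+ q :* f :+ r)
        := p :* (a :* x :+ b :* y :+ e) :+ q :* (c :* x :+ d :* y :+ f) :+ r) refl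
      where open +-*-Solver
    row : ∀ p q r →
      ι (p ℤ.* T.m₁₁ ℤ.+ q ℤ.* T.m₂₁) * x + ι (p ℤ.* T.m₁₂ ℤ.+ q ℤ.* T.m₂₂) * y
        + ι (p ℤ.* T.w₁ ℤ.+ q ℤ.* T.w₂ ℤ.+ r)
      ≡ ι p * (ι T.m₁₁ * x + ι T.m₁₂ * y + ι T.w₁) + ι q * (ι T.m₂₁ * x + ι T.m₂₂ * y + ι T.w₂) + ι r
    row p q r
      rewrite ι-linear p T.m₁₁ q T.m₂₁ | ι-linear p T.m₁₂ q T.m₂₂ | ι-affine p T.w₁ q T.w₂ r =
      compose (ι p) (ι q) (ι r) (ι T.m₁₁) (ι T.m₁₂) (ι T.m₂₁) (ι T.m₂₂) (ι T.w₁) (ι T.w₂) x y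

  ≅-trans : ∀ {Q₁ Q₂ Q₃} → Q₁ ≅ Q₂ → Q₂ ≅ Q₃ → Q₁ ≅ Q₃
  ≅-trans {Q₃ = Q₃} (T , image , preimage) (S , image′ , preimage′) =
    S ∘ T ,
    (λ p p∈Q₁ → subst Q₃ (sym (apply-∘ S T p)) (image′ _ (image p p∈Q₁))) ,
    (λ r r∈Q₃ →
      let (q , q∈Q₂ , Sq≡r) = preimage′ r r∈Q₃
          (p , p∈Q₁ , Tp≡q) = preimage q q∈Q₂
      in p , p∈Q₁ , trans (apply-∘ S T p) (trans (cong (apply S) Tp≡q) Sq≡r))

  P-image : ∀ T b n {A′ B′ C′ D′} →
    applyℤ T (+ 0 , + 0) ≡ A′ → applyℤ T (+ 1 , + 0) ≡ B′ →
    applyℤ T (+ b , + n) ≡ C′ → applyℤ T (+ ℕ.suc b , + n) ≡ D′ →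
    Maps T (P b n) (ConvHull4 A′ B′ C′ D′)
  P-image T b n = ConvHull4-image T (+ 0 , + 0) (+ 1 , + 0) (+ b , + n) (+ ℕ.suc b , + n)

  reflection : AffUnimod
  reflection = record
    { m₁₁ = ℤ.- (+ 1) ; m₁₂ = + 1 ; m₂₁ = + 0 ; m₂₂ = + 1 ; w₁ = + 1 ; w₂ = + 0 ; det±1 = inj₂ refl }

  P-reflect : ∀ b c {n} → b ℕ.+ c ≡ n → P b n ≅ P c n
  P-reflect b c refl = reflection ,
    Maps-respʳ-≐ reflection
      (ConvHull4-≐-swap-pairs (+ 1 , + 0) (+ 0 , + 0) (+ ℕ.suc c , + (b ℕ.+ c)) (+ c , + (b ℕ.+ c)))
      (P-image reflection b (b ℕ.+ c) refl refl
        (cong₂ _,_ (top-left-x (+ b) (+ c)) (keep-height (+ b) (+ (b ℕ.+ c))))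
        (cong₂ _,_ (top-right-x (+ b) (+ c)) (keep-height (+ ℕ.suc b) (+ (b ℕ.+ c)))))
    where
    keep-height : ∀ x y → + 0 ℤ.* x ℤ.+ + 1 ℤ.* y ℤ.+ + 0 ≡ y
    keep-height = solve-∀
    top-left-x : ∀ x y → ℤ.- (+ 1) ℤ.* x ℤ.+ + 1 ℤ.* (x ℤ.+ y) ℤ.+ + 1 ≡ + 1 ℤ.+ y
    top-left-x = solve-∀
    top-right-x : ∀ x y → ℤ.- (+ 1) ℤ.* (+ 1 ℤ.+ x) ℤ.+ + 1 ℤ.* (x ℤ.+ y) ℤ.+ + 1 ≡ y
    top-right-x = solve-∀

  P-inverse : ∀ b c k n → b ℕ.* c ≡ 1 ℕ.+ k ℕ.* n → P b n ≅ P c n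
  P-inverse b c k n bc≡1+kn = T ,
    Maps-respʳ-≐ T (ConvHull4-≐-swap-middle (+ 0 , + 0) (+ c , + n) (+ 1 , + 0) (+ ℕ.suc c , + n))
      (P-image T b n
        (cong₂ _,_ (at-origin (+ c) (ℤ.- (+ k))) (at-origin (+ n) (ℤ.- (+ b))))
        (cong₂ _,_ (first-column (+ c) (ℤ.- (+ k))) (first-column (+ n) (ℤ.- (+ b))))
        (cong₂ _,_ (trans (top-left-x (+ b) (+ c) (+ k) (+ n)) bc-kn≡1) (top-left-y (+ b) (+ n)))
        (cong₂ _,_ (trans (top-right-x (+ b) (+ c) (+ k) (+ n)) (cong (ℤ._+ + c) bc-kn≡1))
                   (top-right-y (+ b) (+ n))))
    where
    bc-kn≡1 : + b ℤ.* + c ℤ.- + k ℤ.* + n ≡ + 1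
    bc-kn≡1 = begin
      + b ℤ.* + c ℤ.- + k ℤ.* + n          ≡⟨ cong₂ ℤ._-_ (sym (pos-* b c)) (sym (pos-* k n)) ⟩
      + (b ℕ.* c) ℤ.- + (k ℕ.* n)          ≡⟨ cong (λ m → + m ℤ.- + (k ℕ.* n)) bc≡1+kn ⟩
      + 1 ℤ.+ + (k ℕ.* n) ℤ.- + (k ℕ.* n)  ≡⟨ cancel (+ 1) (+ (k ℕ.* n)) ⟩
      + 1                                  ∎
      where
      open ≡-Reasoning
      cancel : ∀ x y → x ℤ.+ y ℤ.- y ≡ x
      cancel = solve-∀
    det≡-1 : + c ℤ.* ℤ.- (+ b) ℤ.- ℤ.- (+ k) ℤ.* + n ≡ ℤ.- (+ 1)
    det≡-1 = trans (negate (+ b) (+ c) (+ k) (+ n)) (cong ℤ.-_ bc-kn≡1)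
      where
      negate : ∀ b c k n → c ℤ.* ℤ.- b ℤ.- ℤ.- k ℤ.* n ≡ ℤ.- (b ℤ.* c ℤ.- k ℤ.* n)
      negate = solve-∀
    T : AffUnimod
    T = record
      { m₁₁ = + c ; m₁₂ = ℤ.- (+ k) ; m₂₁ = + n ; m₂₂ = ℤ.- (+ b) ; w₁ = + 0 ; w₂ = + 0 ; det±1 = inj₂ det≡-1 }
    at-origin : ∀ x y → x ℤ.* + 0 ℤ.+ y ℤ.* + 0 ℤ.+ + 0 ≡ + 0
    at-origin = solve-∀
    first-column : ∀ x y → x ℤ.* + 1 ℤ.+ y ℤ.* + 0 ℤ.+ + 0 ≡ x
    first-column = solve-∀
    top-left-x : ∀ b c k n → c ℤ.* b ℤ.+ ℤ.- k ℤ.* n ℤ.+ + 0 ≡ b ℤ.* c ℤ.- k ℤ.* n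
    top-left-x = solve-∀
    top-left-y : ∀ b n → n ℤ.* b ℤ.+ ℤ.- b ℤ.* n ℤ.+ + 0 ≡ + 0
    top-left-y = solve-∀
    top-right-x : ∀ b c k n → c ℤ.* (+ 1 ℤ.+ b) ℤ.+ ℤ.- k ℤ.* n ℤ.+ + 0 ≡ b ℤ.* c ℤ.- k ℤ.* n ℤ.+ c
    top-right-x = solve-∀
    top-right-y : ∀ b n → n ℤ.* (+ 1 ℤ.+ b) ℤ.+ ℤ.- b ℤ.* n ℤ.+ + 0 ≡ n
    top-right-y = solve-∀

open UnimodularEquivalence using (_≅_; ≅-refl; ≅-trans; P-reflect; P-inverse)

open import Data.Nat using (ℕ; _≤_; _<_; _*_; _∸_)
open import Data.Nat.GCD using (gcd)
open import Data.Nat.Divisibility using (_∣_)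
open import Data.Fin using (Fin; zero; suc)
open import Relation.Binary.PropositionalEquality using (_≡_)

open import Data.Nat using (_+_)
open import Data.Nat.Divisibility using (divides)
open import Data.Nat.Properties using (m+[n∸m]≡n; <⇒≤; +-comm; *-comm; *-mono-≤)
open import Relation.Binary.PropositionalEquality using (sym; trans; cong)

lemma9 : (a n ainv : ℕ) → 1 < n → 1 ≤ a → a < n → gcd a n ≡ 1 →
    1 ≤ ainv → ainv < n → n ∣ (a * ainv ∸ 1) →
    (i j : Fin 4) →
    UnimodEquiv
      (P (lookup4 a (n ∸ a) ainv (n ∸ ainv) i) n)
      (P (lookup4 a (n ∸ a) ainv (n ∸ ainv) j) n)
lemma9 a n ainv _ 1≤a a<n _ 1≤ainv ainv<n (divides q a*ainv∸1≡q*n) i j =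
  ≅-trans {Q₂ = P a n} (to-Pa i) (from-Pa j)
  where
  Pᵢ : Fin 4 → Point → Set
  Pᵢ i = P (lookup4 a (n ∸ a) ainv (n ∸ ainv) i) n
  a*ainv≡1+q*n : a * ainv ≡ 1 + q * n
  a*ainv≡1+q*n = trans (sym (m+[n∸m]≡n (*-mono-≤ 1≤a 1≤ainv))) (cong (1 +_) a*ainv∸1≡q*n)
  ainv*a≡1+q*n : ainv * a ≡ 1 + q * n
  ainv*a≡1+q*n = trans (*-comm ainv a) a*ainv≡1+q*n
  a+[n∸a]≡n : a + (n ∸ a) ≡ n
  a+[n∸a]≡n = m+[n∸m]≡n (<⇒≤ a<n)
  ainv+[n∸ainv]≡n : ainv + (n ∸ ainv) ≡ n
  ainv+[n∸ainv]≡n = m+[n∸m]≡n (<⇒≤ ainv<n)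
  from-Pa : ∀ j → P a n ≅ Pᵢ j
  from-Pa zero = ≅-refl
  from-Pa (suc zero) = P-reflect a (n ∸ a) a+[n∸a]≡n
  from-Pa (suc (suc zero)) = P-inverse a ainv q n a*ainv≡1+q*n
  from-Pa (suc (suc (suc zero))) =
    ≅-trans {Q₂ = P ainv n}
      (P-inverse a ainv q n a*ainv≡1+q*n)
      (P-reflect ainv (n ∸ ainv) ainv+[n∸ainv]≡n)
  to-Pa : ∀ i → Pᵢ i ≅ P a n
  to-Pa zero = ≅-refl
  to-Pa (suc zero) = P-reflect (n ∸ a) a (trans (+-comm (n ∸ a) a) a+[n∸a]≡n)
  to-Pa (suc (suc zero)) = P-inverse ainv a q n ainv*a≡1+q*n
  to-Pa (suc (suc (suc zero))) =
    ≅-trans {Q₂ = P ainv n}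
      (P-reflect (n ∸ ainv) ainv (trans (+-comm (n ∸ ainv) ainv) ainv+[n∸ainv]≡n))
      (P-inverse ainv a q n ainv*a≡1+q*n)
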